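{- Let $p\geq 3$ be an integer. A graph $G$ on $n$ vertices is a nontrivial uniquely $B_p$-saturated graph with girth $4$ if and only if $G$ is a strongly regular graph with parameters $(n,k,0,p)$ for some $k$.
   Context: All graphs are finite, simple and undirected. The book graph $B_p$ with $p$ pages consists of an edge $uv$ together with $p$ further vertices each adjacent to both $u$ and $v$ (i.e. $p$ triangles sharing a common edge); it has $p+2$ vertices. For a graph $H$, a graph $G$ is uniquely $H$-saturated if $G$ contains no subgraph isomorphic to $H$, but for every pair of non-adjacent vertices $u,v$ of $G$, the graph $G+uv$ contains exactly one subgraph isomorphic to $H$. A uniquely $H$-saturated graph is nontrivial if it has at least $|V(H)|$ vertices. The girth is the minimum length of a cycle. A graph on $n$ vertices is strongly regular with parameters $(n,k,\lambda,\mu)$ if it is neither complete nor edgeless, every vertex has degree $k$, every pair of adjacent vertices has exactly $\lambda$ common neighbors, and every pair of non-adjacent vertices has exactly $\mu$ common neighbors. -}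

module Defs where

open import Data.Nat using (ℕ; zero; suc; _+_; _<_; _≤_)
open import Data.Fin using (Fin; zero; suc; inject₁; fromℕ; _≟_)
open import Data.Fin.Properties using ()
open import Data.Bool using (Bool; true; false; _∧_; _∨_; if_then_else_)
open import Data.List using (List; length; filter; map; sum)
open import Data.List using () renaming (allFin to allFinL)
open import Data.Product using (Σ; ∃; ∃-syntax; _×_; _,_)
open import Relation.Nullary using (¬_; Dec; yes; no)
open import Relation.Nullary.Decidable using (⌊_⌋)
open import Relation.Binary.PropositionalEquality using (_≡_; _≢_; refl)
open import Function.Definitions using (Injective)

record Graph (n : ℕ) : Set where
  field
    adj    : Fin n → Fin n → Bool
    sym    : ∀ x y → adj x y ≡ adj y x
    irrefl : ∀ x → adj x x ≡ false
open Graph public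

Adj : ∀ {n} → Graph n → Fin n → Fin n → Set
Adj G x y = adj G x y ≡ true

addAdj : ∀ {n} → Graph n → Fin n → Fin n → Fin n → Fin n → Bool
addAdj G u v x y =
  adj G x y ∨ ((⌊ x ≟ u ⌋ ∧ ⌊ y ≟ v ⌋) ∨ (⌊ x ≟ v ⌋ ∧ ⌊ y ≟ u ⌋))

addEdge : ∀ {n} (G : Graph n) (u v : Fin n) → u ≢ v → Graph n
addEdge G u v u≢v = record
  { adj = addAdj G u v
  ; sym = symP
  ; irrefl = irr }
  where
  open import Data.Bool.Properties using (∨-comm)
  open import Relation.Binary.PropositionalEquality using (refl; cong₂; trans; sym)
  symP : ∀ x y → addAdj G u v x y ≡ addAdj G u v y x
  symP x y with x ≟ u | y ≟ v | x ≟ v | y ≟ u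
  ... | a | b | c | d =
    cong₂ _∨_ (Graph.sym G x y)
      (trans (∨-comm (⌊ a ⌋ ∧ ⌊ b ⌋) (⌊ c ⌋ ∧ ⌊ d ⌋))
             (cong₂ _∨_ (∧c ⌊ c ⌋ ⌊ d ⌋) (∧c ⌊ a ⌋ ⌊ b ⌋)))
    where
    open import Data.Bool.Properties using () renaming (∧-comm to ∧c)
  irr : ∀ x → addAdj G u v x x ≡ false
  irr x with x ≟ u | x ≟ v
  ... | yes refl | yes refl = ⊥-elim (u≢v refl)
    where open import Data.Empty using (⊥-elim)
  ... | yes _ | no _ rewrite Graph.irrefl G x = refl
  ... | no _ | yes _ rewrite Graph.irrefl G x = refl
  ... | no _ | no _ rewrite Graph.irrefl G x = refl

-- The book graph B_p on Fin (2 + p): spine 0–1, pages 2..p+1 adjacent to both.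
bookAdj : ∀ p → Fin (2 + p) → Fin (2 + p) → Bool
bookAdj p zero zero = false
bookAdj p zero (suc _) = true
bookAdj p (suc zero) zero = true
bookAdj p (suc zero) (suc zero) = false
bookAdj p (suc zero) (suc (suc _)) = true
bookAdj p (suc (suc _)) zero = true
bookAdj p (suc (suc _)) (suc zero) = true
bookAdj p (suc (suc _)) (suc (suc _)) = false

bookSym : ∀ p x y → bookAdj p x y ≡ bookAdj p y x
bookSym p zero zero = refl
bookSym p zero (suc zero) = refl
bookSym p zero (suc (suc _)) = refl
bookSym p (suc zero) zero = refl
bookSym p (suc zero) (suc zero) = refl
bookSym p (suc zero) (suc (suc _)) = refl
bookSym p (suc (suc _)) zero = refl
bookSym p (suc (suc _)) (suc zero) = refl
bookSym p (suc (suc _)) (suc (suc _)) = refl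

bookIrr : ∀ p x → bookAdj p x x ≡ false
bookIrr p zero = refl
bookIrr p (suc zero) = refl
bookIrr p (suc (suc _)) = refl

Book : (p : ℕ) → Graph (2 + p)
Book p = record { adj = bookAdj p ; sym = bookSym p ; irrefl = bookIrr p }

Embedding : ∀ {m n} → Graph m → Graph n → Set
Embedding {m} {n} H G =
  Σ (Fin m → Fin n) λ f → Injective _≡_ _≡_ f × (∀ x y → Adj H x y → Adj G (f x) (f y))

Contains : ∀ {m n} → Graph m → Graph n → Set
Contains H G = Embedding H G

-- Two embeddings determine the same subgraph of G: the same vertex image
-- set and the same edge image set.
SameSubgraph : ∀ {m n} (H : Graph m) (G : Graph n) → (Fin m → Fin n) → (Fin m → Fin n) → Set
SameSubgraph {m} H G f g =
  (∀ x → ∃[ y ] f x ≡ g y) × (∀ y → ∃[ x ] g y ≡ f x) ×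
  (∀ x y → Adj H x y → ∃[ x' ] ∃[ y' ] (Adj H x' y' × g x' ≡ f x × g y' ≡ f y)) ×
  (∀ x y → Adj H x y → ∃[ x' ] ∃[ y' ] (Adj H x' y' × f x' ≡ g x × f y' ≡ g y))

ExactlyOneCopy : ∀ {m n} → Graph m → Graph n → Set
ExactlyOneCopy H G =
  Σ (Embedding H G) λ e → ∀ (e' : Embedding H G) →
    SameSubgraph H G (Data.Product.proj₁ e) (Data.Product.proj₁ e')
  where import Data.Product

UniquelySaturated : ∀ {m n} → Graph m → Graph n → Set
UniquelySaturated H G =
  ¬ Contains H G ×
  (∀ u v → (u≢v : u ≢ v) → adj G u v ≡ false → ExactlyOneCopy H (addEdge G u v u≢v))

-- Cycle of length suc m (as an injective closed walk c 0, c 1, ..., c m, c 0).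
HasCycle : ∀ {n} → Graph n → ℕ → Set
HasCycle G zero = ⊥
  where open import Data.Empty using (⊥)
HasCycle {n} G (suc m) =
  Σ (Fin (suc m) → Fin n) λ c → Injective _≡_ _≡_ c ×
    (∀ (i : Fin m) → Adj G (c (inject₁ i)) (c (suc i))) × Adj G (c (fromℕ m)) (c zero)

Girth : ∀ {n} → Graph n → ℕ → Set
Girth G g = HasCycle G g × (∀ k → 3 ≤ k → k < g → ¬ HasCycle G k)

count : ∀ {n} → (Fin n → Bool) → ℕ
count {n} P = length (filter (λ w → P w Data.Bool.≟ true) (allFinL n))
  where import Data.Bool

degree : ∀ {n} → Graph n → Fin n → ℕ
degree G v = count (λ w → adj G v w)

commonNbrs : ∀ {n} → Graph n → Fin n → Fin n → ℕ
commonNbrs G u v = count (λ w → adj G u w ∧ adj G v w)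

StronglyRegular : ∀ {n} → Graph n → ℕ → ℕ → ℕ → ℕ → Set
StronglyRegular {n} G n' k l μ =
  n' ≡ n ×
  (∃[ u ] ∃[ v ] (u ≢ v × adj G u v ≡ false)) ×
  (∃[ u ] ∃[ v ] Adj G u v) ×
  (∀ v → degree G v ≡ k) ×
  (∀ u v → Adj G u v → commonNbrs G u v ≡ l) ×
  (∀ u v → u ≢ v → adj G u v ≡ false → commonNbrs G u v ≡ μ)

-- Let G be triangle-free and u, v non-adjacent. A copy of B_p (p ≥ 2) in G + uv must have the
-- new edge uv as its spine, so its pages are common neighbours of u and v in G; hence G + uv
-- contains exactly one B_p precisely when u and v have exactly p common neighbours (fewer give
-- no copy, more give copies with different page sets). Girth 4 means triangle-free (λ = 0)
-- with a 4-cycle, which μ = p ≥ 2 provides. Regularity comes from counting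
-- walks of length 3: for adjacent u, v they number deg v + p (deg u − 1), and this count is
-- symmetric in u and v, so deg u = deg v as p ≠ 1; non-adjacent vertices share a neighbour.

module Submission where

open import Defs hiding (sym)
open import Data.Bool using (Bool; true; false; _∧_)
import Data.Bool as Bool
open import Data.Bool.Properties using (∧-conicalˡ; ∧-conicalʳ; ∧-idem; ∨-zeroʳ; ¬-not)
open import Data.Empty using (⊥; ⊥-elim)
open import Data.Fin using (Fin; zero; suc; _≟_; inject₁; punchIn)
open import Data.Fin.Patterns using (0F; 1F; 2F)
open import Data.Fin.Properties
  using (suc-injective; inject₁-injective; punchInᵢ≢i; any?; injective⇒≤)
open import Data.List using (length; filter; tabulate; allFin; lookup)
open import Data.List.Membership.Propositional using (_∈_)
open import Data.List.Membership.Propositional.Properties using (∈-filter⁺; ∈-allFin)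
open import Data.List.Relation.Unary.Any using (index)
open import Data.List.Relation.Unary.Any.Properties using (lookup-index)
open import Data.Nat using (ℕ; zero; suc; _+_; _*_; _≤_; _<_; _≤?_; s≤s; s≤s⁻¹; z≤n)
open import Data.Nat.Properties
  using (+-*-semiring; +-identityʳ; *-identityʳ; *-zeroʳ; +-cancelˡ-≡; *-cancelˡ-≡;
         ≤-refl; ≤-reflexive; ≤-trans; ≤-antisym; <-irrefl; ≰⇒>)
open import Data.Nat.Tactic.RingSolver using (solve-∀)
open import Data.Product using (Σ; ∃-syntax; _×_; _,_; proj₁; proj₂)
open import Data.Sum using (_⊎_; inj₁; inj₂)
import Data.Sum
open import Data.Vec.Functional using (Vector; _∷_; []; removeAt)
open import Function using (_∘_; id; case_of_)
open import Function.Bundles using (_⇔_; mk⇔)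
open import Function.Definitions using (Injective)
open import Relation.Nullary using (yes; no; ¬_)
open import Relation.Binary.PropositionalEquality
  using (_≡_; _≢_; refl; sym; trans; cong; cong₂; subst; module ≡-Reasoning)

open import Algebra.Properties.Semiring.Sum +-*-semiring
  using (sum; sum-syntax; sum-cong-≗; sum-remove; ∑-comm; *-distribˡ-sum)

indicator : Bool → ℕ
indicator true  = 1
indicator false = 0

indicator-∧ : ∀ a b → indicator (a ∧ b) ≡ indicator a * indicator b
indicator-∧ true  b = sym (+-identityʳ (indicator b))
indicator-∧ false b = refl

length-filter-tabulate : ∀ {n} {A : Set} (P : A → Bool) (f : Fin n → A) →
  length (filter (λ a → P a Bool.≟ true) (tabulate f)) ≡ ∑[ i < n ] indicator (P (f i))
length-filter-tabulate {zero}  P f = refl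
length-filter-tabulate {suc n} P f with P (f zero)
... | true  = cong suc (length-filter-tabulate P (f ∘ suc))
... | false = length-filter-tabulate P (f ∘ suc)

count≡sum : ∀ {n} (P : Fin n → Bool) → count P ≡ ∑[ w < n ] indicator (P w)
count≡sum P = length-filter-tabulate P id

count-suc : ∀ {n} (P : Fin (suc n) → Bool) → count P ≡ indicator (P zero) + count (P ∘ suc)
count-suc P = trans (count≡sum P) (cong (indicator (P zero) +_) (sym (count≡sum (P ∘ suc))))

count-none : ∀ {n} (P : Fin n → Bool) → (∀ w → P w ≡ false) → count P ≡ 0
count-none {zero}  P _    = refl
count-none {suc n} P none rewrite count-suc P | none zero = count-none (P ∘ suc) (none ∘ suc)

[]-injective : ∀ {n} → Injective _≡_ _≡_ ([] {A = Fin n})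
[]-injective {x = ()}

cons-injective : ∀ {m n} {w : Fin n} {f : Fin m → Fin n} →
  (∀ i → w ≢ f i) → Injective _≡_ _≡_ f → Injective _≡_ _≡_ (w ∷ f)
cons-injective w∉f f-inj {zero}  {zero}  eq = refl
cons-injective w∉f f-inj {zero}  {suc j} eq = ⊥-elim (w∉f j eq)
cons-injective w∉f f-inj {suc i} {zero}  eq = ⊥-elim (w∉f i (sym eq))
cons-injective w∉f f-inj {suc i} {suc j} eq = cong suc (f-inj eq)

injection⇒≤count : ∀ {m n} (P : Fin n → Bool) (f : Fin m → Fin n) → Injective _≡_ _≡_ f →
  (∀ i → P (f i) ≡ true) → m ≤ count P
injection⇒≤count {n = n} P f f-inj Pf = injective⇒≤ {f = index ∘ position} position-injective
  where
  members = filter (λ w → P w Bool.≟ true) (allFin n)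
  position : ∀ i → f i ∈ members
  position i = ∈-filter⁺ (λ w → P w Bool.≟ true) (∈-allFin (f i)) (Pf i)
  position-injective : Injective _≡_ _≡_ (index ∘ position)
  position-injective {i} {j} eq =
    f-inj (trans (lookup-index (position i))
                 (trans (cong (lookup members) eq) (sym (lookup-index (position j)))))

≤count⇒injection : ∀ {m n} (P : Fin n → Bool) → m ≤ count P →
  Σ (Fin m → Fin n) λ f → Injective _≡_ _≡_ f × (∀ i → P (f i) ≡ true)
≤count⇒injection {zero} P _ = (λ ()) , (λ { {()} }) , (λ ())
≤count⇒injection {suc m} {zero} P ()
≤count⇒injection {suc m} {suc n} P m≤count
  rewrite count-suc P with P zero in P0
... | false with f , f-inj , Pf ← ≤count⇒injection (P ∘ suc) m≤count =
  suc ∘ f , (λ eq → f-inj (suc-injective eq)) , Pf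
... | true with f , f-inj , Pf ← ≤count⇒injection (P ∘ suc) (s≤s⁻¹ m≤count) =
  zero ∷ suc ∘ f , cons-injective (λ i ()) (λ eq → f-inj (suc-injective eq)) ,
  λ { zero → P0 ; (suc i) → Pf i }

count≤⇒onto : ∀ {m n} (P : Fin n → Bool) (f : Fin m → Fin n) → Injective _≡_ _≡_ f →
  (∀ i → P (f i) ≡ true) → count P ≤ m → ∀ {w} → P w ≡ true → ∃[ i ] f i ≡ w
count≤⇒onto P f f-inj Pf count≤m {w} Pw with any? (λ i → f i ≟ w)
... | yes hit = hit
... | no miss =
  ⊥-elim (<-irrefl refl (≤-trans (injection⇒≤count P (w ∷ f) w∷f-inj Pw∷f) count≤m))
  where
  w∷f-inj : Injective _≡_ _≡_ (w ∷ f)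
  w∷f-inj = cons-injective (λ i eq → miss (i , sym eq)) f-inj
  Pw∷f : ∀ i → P ((w ∷ f) i) ≡ true
  Pw∷f zero    = Pw
  Pw∷f (suc i) = Pf i

sum-scaled-except-at : ∀ {n} (c : ℕ) (s t : Vector ℕ n) (i : Fin n) →
  (∀ j → j ≢ i → s j ≡ c * t j) → sum s + c * t i ≡ s i + c * sum t
sum-scaled-except-at {suc n} c s t i s≡ct = begin
  sum s + c * t i                         ≡⟨ cong (_+ c * t i) (sum-remove {i = i} s) ⟩
  s i + sum (removeAt s i) + c * t i      ≡⟨ cong (λ z → s i + z + c * t i) elsewhere ⟩
  s i + c * sum (removeAt t i) + c * t i  ≡⟨ regroup (s i) c (sum (removeAt t i)) (t i) ⟩
  s i + c * (t i + sum (removeAt t i))    ≡⟨ cong (λ z → s i + c * z) (sum-remove {i = i} t) ⟨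
  s i + c * sum t                         ∎
  where
  open ≡-Reasoning
  elsewhere : sum (removeAt s i) ≡ c * sum (removeAt t i)
  elsewhere = trans (sum-cong-≗ (λ j → s≡ct (punchIn i j) (punchInᵢ≢i i j)))
                    (sym (*-distribˡ-sum c (removeAt t i)))
  regroup : ∀ a c r b → a + c * r + c * b ≡ a + c * (b + r)
  regroup = solve-∀

infix 4 _∈｛_,_｝

_∈｛_,_｝ : {A : Set} → A → A → A → Set
x ∈｛ u , v ｝ = x ≡ u ⊎ x ≡ v

pair-⊆ : {A : Set} {u v x y z : A} →
  x ∈｛ u , v ｝ → y ∈｛ u , v ｝ → x ≢ y → z ∈｛ u , v ｝ → z ∈｛ x , y ｝
pair-⊆ (inj₁ refl) (inj₁ refl) x≢y _ = ⊥-elim (x≢y refl)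
pair-⊆ (inj₁ refl) (inj₂ refl) _   z = z
pair-⊆ (inj₂ refl) (inj₁ refl) _   z = Data.Sum.swap z
pair-⊆ (inj₂ refl) (inj₂ refl) x≢y _ = ⊥-elim (x≢y refl)

module _ {n} (G : Graph n) where

  adj⇒≢ : ∀ {x y} → Adj G x y → x ≢ y
  adj⇒≢ {x} xy refl with () ← trans (sym xy) (irrefl G x)

  adj-sym : ∀ {x y} → Adj G x y → Adj G y x
  adj-sym {x} {y} xy = trans (Graph.sym G y x) xy

  isCommonNbr : Fin n → Fin n → Fin n → Bool
  isCommonNbr u v w = adj G u w ∧ adj G v w

  common-nbr : ∀ {u v w} → Adj G u w → Adj G v w → isCommonNbr u v w ≡ true
  common-nbr uw vw rewrite uw | vw = refl

  common-nbrˡ : ∀ {u v w} → isCommonNbr u v w ≡ true → Adj G u w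
  common-nbrˡ = ∧-conicalˡ _ _

  common-nbrʳ : ∀ {u v w} → isCommonNbr u v w ≡ true → Adj G v w
  common-nbrʳ = ∧-conicalʳ _ _

  TriangleFree : Set
  TriangleFree = ∀ {a b c} → Adj G a b → Adj G b c → Adj G a c → ⊥

  triangle⇒cycle₃ : ∀ {a b c} → Adj G a b → Adj G b c → Adj G a c → HasCycle G 3
  triangle⇒cycle₃ {a} {b} {c} ab bc ac =
    a ∷ b ∷ c ∷ [] ,
    cons-injective (λ { 0F → adj⇒≢ ab ; 1F → adj⇒≢ ac })
      (cons-injective (λ { 0F → adj⇒≢ bc }) (cons-injective (λ ()) []-injective)) ,
    (λ { 0F → ab ; 1F → bc }) ,
    adj-sym ac

  ¬cycle₃⇒triangleFree : ¬ HasCycle G 3 → TriangleFree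
  ¬cycle₃⇒triangleFree ¬cycle₃ ab bc ac = ¬cycle₃ (triangle⇒cycle₃ ab bc ac)

  triangleFree⇒¬cycle₃ : TriangleFree → ¬ HasCycle G 3
  triangleFree⇒¬cycle₃ triangleFree (_ , _ , path , closing) =
    triangleFree (path 0F) (path 1F) (adj-sym closing)

  triangleFree⇒commonNbrs≡0 : TriangleFree → ∀ {u v} → Adj G u v → commonNbrs G u v ≡ 0
  triangleFree⇒commonNbrs≡0 triangleFree uv =
    count-none (isCommonNbr _ _) λ _ →
      ¬-not λ common → triangleFree uv (common-nbrʳ common) (common-nbrˡ common)

  commonNbrs≡0⇒triangleFree : (∀ u v → Adj G u v → commonNbrs G u v ≡ 0) → TriangleFree
  commonNbrs≡0⇒triangleFree λ≡0 {a} {b} {c} ab bc ac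
    with () ← subst (1 ≤_) (λ≡0 a c ac)
                (injection⇒≤count (isCommonNbr a c) (λ _ → b) (λ { {0F} {0F} _ → refl })
                                  (λ _ → common-nbr ab (adj-sym bc)))

  common-nbrs⇒cycle₄ : ∀ {u v w₀ w₁} → u ≢ v → w₀ ≢ w₁ →
    isCommonNbr u v w₀ ≡ true → isCommonNbr u v w₁ ≡ true → HasCycle G 4
  common-nbrs⇒cycle₄ {u} {v} {w₀} {w₁} u≢v w₀≢w₁ w₀-common w₁-common =
    u ∷ w₀ ∷ v ∷ w₁ ∷ [] ,
    cons-injective (λ { 0F → adj⇒≢ uw₀ ; 1F → u≢v ; 2F → adj⇒≢ uw₁ })
      (cons-injective (λ { 0F → adj⇒≢ (adj-sym vw₀) ; 1F → w₀≢w₁ })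
        (cons-injective (λ { 0F → adj⇒≢ vw₁ }) (cons-injective (λ ()) []-injective))) ,
    (λ { 0F → uw₀ ; 1F → adj-sym vw₀ ; 2F → vw₁ }) ,
    adj-sym uw₁
    where
    uw₀ = common-nbrˡ w₀-common
    vw₀ = common-nbrʳ w₀-common
    uw₁ = common-nbrˡ w₁-common
    vw₁ = common-nbrʳ w₁-common

page : ∀ {p} → Fin p → Fin (2 + p)
page i = suc (suc i)

book-adj⁻ : ∀ {p} {x y : Fin (2 + p)} → Adj (Book p) x y → x ∈｛ 0F , 1F ｝ ⊎ y ∈｛ 0F , 1F ｝
book-adj⁻ {x = 0F}                 _ = inj₁ (inj₁ refl)
book-adj⁻ {x = 1F}                 _ = inj₁ (inj₂ refl)
book-adj⁻ {x = suc (suc _)} {y = 0F} _ = inj₂ (inj₁ refl)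
book-adj⁻ {x = suc (suc _)} {y = 1F} _ = inj₂ (inj₂ refl)

book-adj⁺ : ∀ {p} {x y : Fin (2 + p)} → x ≢ y → x ∈｛ 0F , 1F ｝ ⊎ y ∈｛ 0F , 1F ｝ →
  Adj (Book p) x y
book-adj⁺ {x = 0F}          {0F}          x≢y _ = ⊥-elim (x≢y refl)
book-adj⁺ {x = 0F}          {suc _}       _   _ = refl
book-adj⁺ {x = 1F}          {0F}          _   _ = refl
book-adj⁺ {x = 1F}          {1F}          x≢y _ = ⊥-elim (x≢y refl)
book-adj⁺ {x = 1F}          {suc (suc _)} _   _ = refl
book-adj⁺ {x = suc (suc _)} {0F}          _   _ = refl
book-adj⁺ {x = suc (suc _)} {1F}          _   _ = refl
book-adj⁺ {x = suc (suc _)} {suc (suc _)} _ (inj₁ (inj₁ ()))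
book-adj⁺ {x = suc (suc _)} {suc (suc _)} _ (inj₁ (inj₂ ()))
book-adj⁺ {x = suc (suc _)} {suc (suc _)} _ (inj₂ (inj₁ ()))
book-adj⁺ {x = suc (suc _)} {suc (suc _)} _ (inj₂ (inj₂ ()))

spine≢page : ∀ {p m} {f : Fin (2 + p) → Fin m} → Injective _≡_ _≡_ f →
  ∀ {x} → x ∈｛ 0F , 1F ｝ → ∀ i → f x ≢ f (page i)
spine≢page f-inj (inj₁ refl) i eq with () ← f-inj eq
spine≢page f-inj (inj₂ refl) i eq with () ← f-inj eq

unique-copy⇒same-vertices : ∀ {m k} {H : Graph m} {K : Graph k} → ExactlyOneCopy H K →
  (e₁ e₂ : Embedding H K) → ∀ x → ∃[ y ] proj₁ e₂ x ≡ proj₁ e₁ y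
unique-copy⇒same-vertices (_ , unique) e₁ e₂ x
  with y , e₂x≡ey ← proj₁ (proj₂ (unique e₂)) x
  with z , ey≡e₁z ← proj₁ (unique e₁) y
  = z , trans e₂x≡ey ey≡e₁z

module NewEdge {n} (G : Graph n) {u v : Fin n} (u≢v : u ≢ v) where

  G⁺ : Graph n
  G⁺ = addEdge G u v u≢v

  edge⁺-cases : ∀ {x y} → Adj G⁺ x y → Adj G x y ⊎ (x ∈｛ u , v ｝ × y ∈｛ u , v ｝)
  edge⁺-cases {x} {y} xy with adj G x y | x ≟ u | y ≟ v | x ≟ v | y ≟ u
  ... | true  | _       | _       | _       | _       = inj₁ refl
  ... | false | yes x≡u | yes y≡v | _       | _       = inj₂ (inj₁ x≡u , inj₂ y≡v)
  ... | false | _       | _       | yes x≡v | yes y≡u = inj₂ (inj₂ x≡v , inj₁ y≡u)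
  edge⁺-cases () | false | no _  | _     | no _  | _
  edge⁺-cases () | false | no _  | _     | yes _ | no _
  edge⁺-cases () | false | yes _ | no _  | no _  | _
  edge⁺-cases () | false | yes _ | no _  | yes _ | no _

  old-edge : ∀ {x y} → Adj G⁺ x y → ¬ y ∈｛ u , v ｝ → Adj G x y
  old-edge xy y∉uv with edge⁺-cases xy
  ... | inj₁ xy-old     = xy-old
  ... | inj₂ (_ , y∈uv) = ⊥-elim (y∉uv y∈uv)

  edge⇒edge⁺ : ∀ {x y} → Adj G x y → Adj G⁺ x y
  edge⇒edge⁺ xy = cong (Bool._∨ _) xy

  new-edge : Adj G⁺ u v
  new-edge with u ≟ u | v ≟ v
  ... | yes _   | yes _   = ∨-zeroʳ (adj G u v)
  ... | no u≢u′ | _       = ⊥-elim (u≢u′ refl)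
  ... | _       | no v≢v′ = ⊥-elim (v≢v′ refl)

  triangle⁺ : TriangleFree G → ∀ {x y z} → Adj G x y → Adj G⁺ x z → Adj G⁺ y z →
    z ∈｛ u , v ｝ × (x ∈｛ u , v ｝ ⊎ y ∈｛ u , v ｝)
  triangle⁺ triangleFree xy xz yz with edge⁺-cases xz | edge⁺-cases yz
  ... | inj₂ (x∈uv , z∈uv) | _                  = z∈uv , inj₁ x∈uv
  ... | inj₁ _             | inj₂ (y∈uv , z∈uv) = z∈uv , inj₂ y∈uv
  ... | inj₁ xz-old        | inj₁ yz-old        = ⊥-elim (triangleFree xy yz-old xz-old)

  OnNewEdge : ∀ {p} → (Fin (2 + p) → Fin n) → Set
  OnNewEdge f = f 0F ∈｛ u , v ｝ × f 1F ∈｛ u , v ｝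

  spine-on-new-edge : TriangleFree G → ∀ {q} (e : Embedding (Book (2 + q)) G⁺) → OnNewEdge (proj₁ e)
  spine-on-new-edge triangleFree (f , f-inj , f-hom) with edge⁺-cases (f-hom 0F 1F refl)
  ... | inj₂ spine     = spine
  ... | inj₁ spine-old =
    -- Each page would close a triangle of G⁺ through the new edge, putting both apexes and
    -- a spine vertex, three distinct vertices, into {u, v}.
    ⊥-elim (Data.Sum.[ spine-off-edge (inj₁ refl) , spine-off-edge (inj₂ refl) ] (proj₂ (apex 0F)))
    where
    apex : ∀ i → f (page i) ∈｛ u , v ｝ × (f 0F ∈｛ u , v ｝ ⊎ f 1F ∈｛ u , v ｝)
    apex i = triangle⁺ triangleFree spine-old (f-hom 0F (page i) refl) (f-hom 1F (page i) refl)
    spine-off-edge : ∀ {x} → x ∈｛ 0F , 1F ｝ → ¬ f x ∈｛ u , v ｝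
    spine-off-edge x∈spine fx∈uv
      with pair-⊆ (proj₁ (apex 0F)) (proj₁ (apex 1F)) (λ eq → case f-inj eq of λ ()) fx∈uv
    ... | inj₁ eq = spine≢page f-inj x∈spine 0F eq
    ... | inj₂ eq = spine≢page f-inj x∈spine 1F eq

  module Copy {p} (e : Embedding (Book p) G⁺) (on-edge : OnNewEdge (proj₁ e)) where

    private
      f = proj₁ e
      f-inj = proj₁ (proj₂ e)
      f-hom = proj₂ (proj₂ e)

    endpoint⇒spine-image : ∀ {x} → x ∈｛ u , v ｝ → x ∈｛ f 0F , f 1F ｝
    endpoint⇒spine-image = pair-⊆ (proj₁ on-edge) (proj₂ on-edge) (λ eq → case f-inj eq of λ ())

    page∉edge : ∀ i → ¬ f (page i) ∈｛ u , v ｝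
    page∉edge i fi∈uv with endpoint⇒spine-image fi∈uv
    ... | inj₁ eq = spine≢page f-inj (inj₁ refl) i (sym eq)
    ... | inj₂ eq = spine≢page f-inj (inj₂ refl) i (sym eq)

    page-common : ∀ i → isCommonNbr G u v (f (page i)) ≡ true
    page-common i = common-nbr G (to-page (endpoint⇒spine-image (inj₁ refl)))
                                 (to-page (endpoint⇒spine-image (inj₂ refl)))
      where
      to-page : ∀ {x} → x ∈｛ f 0F , f 1F ｝ → Adj G x (f (page i))
      to-page (inj₁ refl) = old-edge (f-hom 0F (page i) refl) (page∉edge i)
      to-page (inj₂ refl) = old-edge (f-hom 1F (page i) refl) (page∉edge i)

    page-injective : Injective _≡_ _≡_ (f ∘ page)
    page-injective eq = suc-injective (suc-injective (f-inj eq))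

    spine⇒endpoint : ∀ {x} → x ∈｛ 0F , 1F ｝ → f x ∈｛ u , v ｝
    spine⇒endpoint (inj₁ refl) = proj₁ on-edge
    spine⇒endpoint (inj₂ refl) = proj₂ on-edge

    endpoint⇒spine : ∀ {x} → f x ∈｛ u , v ｝ → x ∈｛ 0F , 1F ｝
    endpoint⇒spine {0F}          _     = inj₁ refl
    endpoint⇒spine {1F}          _     = inj₂ refl
    endpoint⇒spine {suc (suc i)} fx∈uv = ⊥-elim (page∉edge i fx∈uv)

  canonical-copy : ∀ {p} (g : Fin p → Fin n) → Injective _≡_ _≡_ g →
    (∀ i → isCommonNbr G u v (g i) ≡ true) → Embedding (Book p) G⁺
  canonical-copy {p} g g-inj common = u ∷ v ∷ g , injective , hom
    where
    injective : Injective _≡_ _≡_ (u ∷ v ∷ g)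
    injective = cons-injective (λ { 0F → u≢v ; (suc i) → adj⇒≢ G (common-nbrˡ G (common i)) })
                  (cons-injective (λ i → adj⇒≢ G (common-nbrʳ G (common i))) g-inj)
    hom : ∀ x y → Adj (Book p) x y → Adj G⁺ ((u ∷ v ∷ g) x) ((u ∷ v ∷ g) y)
    hom 0F            1F            _ = new-edge
    hom 0F            (suc (suc j)) _ = edge⇒edge⁺ (common-nbrˡ G (common j))
    hom 1F            0F            _ = adj-sym G⁺ new-edge
    hom 1F            (suc (suc j)) _ = edge⇒edge⁺ (common-nbrʳ G (common j))
    hom (suc (suc i)) 0F            _ = edge⇒edge⁺ (adj-sym G (common-nbrˡ G (common i)))
    hom (suc (suc i)) 1F            _ = edge⇒edge⁺ (adj-sym G (common-nbrʳ G (common i)))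

  module _ {p} (φ ψ : Embedding (Book p) G⁺)
           (φ-on-edge : OnNewEdge (proj₁ φ)) (ψ-on-edge : OnNewEdge (proj₁ ψ))
           (few-common-nbrs : commonNbrs G u v ≤ p) where

    private
      module Φ = Copy φ φ-on-edge
      module Ψ = Copy ψ ψ-on-edge

    vertices-⊆ : ∀ x → ∃[ y ] proj₁ φ x ≡ proj₁ ψ y
    vertices-⊆ 0F with Ψ.endpoint⇒spine-image (proj₁ φ-on-edge)
    ... | inj₁ eq = 0F , eq
    ... | inj₂ eq = 1F , eq
    vertices-⊆ 1F with Ψ.endpoint⇒spine-image (proj₂ φ-on-edge)
    ... | inj₁ eq = 0F , eq
    ... | inj₂ eq = 1F , eq
    vertices-⊆ (suc (suc i))
      with j , eq ← count≤⇒onto (isCommonNbr G u v) (proj₁ ψ ∘ page) Ψ.page-injective Ψ.page-common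
                      few-common-nbrs (Φ.page-common i)
      = page j , sym eq

    edges-⊆ : ∀ x y → Adj (Book p) x y →
      ∃[ x′ ] ∃[ y′ ] (Adj (Book p) x′ y′ × proj₁ ψ x′ ≡ proj₁ φ x × proj₁ ψ y′ ≡ proj₁ φ y)
    edges-⊆ x y xy with x′ , φx≡ψx′ ← vertices-⊆ x | y′ , φy≡ψy′ ← vertices-⊆ y =
      x′ , y′ ,
      book-adj⁺ x′≢y′ (Data.Sum.map (spine-preserved φx≡ψx′) (spine-preserved φy≡ψy′) (book-adj⁻ xy)) ,
      sym φx≡ψx′ , sym φy≡ψy′
      where
      x′≢y′ : x′ ≢ y′
      x′≢y′ refl = adj⇒≢ (Book p) xy (proj₁ (proj₂ φ) (trans φx≡ψx′ (sym φy≡ψy′)))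
      spine-preserved : ∀ {z z′} → proj₁ φ z ≡ proj₁ ψ z′ → z ∈｛ 0F , 1F ｝ → z′ ∈｛ 0F , 1F ｝
      spine-preserved eq z∈spine =
        Ψ.endpoint⇒spine (subst (_∈｛ u , v ｝) eq (Φ.spine⇒endpoint z∈spine))

  same-subgraph : ∀ {p} (φ ψ : Embedding (Book p) G⁺) → OnNewEdge (proj₁ φ) → OnNewEdge (proj₁ ψ) →
    commonNbrs G u v ≤ p → SameSubgraph (Book p) G⁺ (proj₁ φ) (proj₁ ψ)
  same-subgraph φ ψ φ-on-edge ψ-on-edge few =
    vertices-⊆ φ ψ φ-on-edge ψ-on-edge few , vertices-⊆ ψ φ ψ-on-edge φ-on-edge few ,
    edges-⊆ φ ψ φ-on-edge ψ-on-edge few , edges-⊆ ψ φ ψ-on-edge φ-on-edge few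

  commonNbrs⇒unique-copy : TriangleFree G → ∀ {q} → commonNbrs G u v ≡ 2 + q →
    ExactlyOneCopy (Book (2 + q)) G⁺
  commonNbrs⇒unique-copy triangleFree μ
    with g , g-inj , g-common ← ≤count⇒injection (isCommonNbr G u v) (≤-reflexive (sym μ))
    = copy ,
      λ e → same-subgraph copy e (inj₁ refl , inj₂ refl) (spine-on-new-edge triangleFree e) (≤-reflexive μ)
    where
    copy = canonical-copy g g-inj g-common

  unique-copy⇒commonNbrs : TriangleFree G → ∀ {q} → ExactlyOneCopy (Book (2 + q)) G⁺ →
    commonNbrs G u v ≡ 2 + q
  unique-copy⇒commonNbrs triangleFree {q} unique@(e , _) = ≤-antisym at-most at-least
    where
    open Copy e (spine-on-new-edge triangleFree e)
    at-least : 2 + q ≤ commonNbrs G u v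
    at-least = injection⇒≤count (isCommonNbr G u v) (proj₁ e ∘ page) page-injective page-common
    at-most : commonNbrs G u v ≤ 2 + q
    at-most with commonNbrs G u v ≤? 2 + q
    ... | yes few = few
    ... | no ≰p with h , h-inj , h-common ← ≤count⇒injection (isCommonNbr G u v) (≰⇒> ≰p)
      = ⊥-elim (h₀-missing (unique-copy⇒same-vertices {H = Book (2 + q)} {K = G⁺}
                                                       unique without-h₀ without-last (page 0F)))
      where
      without-h₀ = canonical-copy (h ∘ suc) (suc-injective ∘ h-inj) (h-common ∘ suc)
      without-last = canonical-copy (h ∘ inject₁) (inject₁-injective ∘ h-inj) (h-common ∘ inject₁)
      h₀-missing : ¬ (∃[ y ] h 0F ≡ (u ∷ v ∷ h ∘ suc) y)
      h₀-missing (0F , eq) = adj⇒≢ G (common-nbrˡ G (h-common 0F)) (sym eq)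
      h₀-missing (1F , eq) = adj⇒≢ G (common-nbrʳ G (h-common 0F)) (sym eq)
      h₀-missing (suc (suc i) , eq) with () ← h-inj eq

walks₃ : ∀ {n} → Graph n → Fin n → Fin n → ℕ
walks₃ {n} G u v =
  ∑[ w < n ] ∑[ x < n ] (indicator (adj G u w) * (indicator (adj G w x) * indicator (adj G x v)))

module _ {n} (G : Graph n) where

  open ≡-Reasoning

  walks₃-sym : ∀ u v → walks₃ G u v ≡ walks₃ G v u
  walks₃-sym u v =
    trans (∑-comm (λ w x → indicator (adj G u w) * (indicator (adj G w x) * indicator (adj G x v))))
          (sum-cong-≗ λ x → sum-cong-≗ λ w → reversed w x)
    where
    reversed : ∀ w x → indicator (adj G u w) * (indicator (adj G w x) * indicator (adj G x v))
                     ≡ indicator (adj G v x) * (indicator (adj G x w) * indicator (adj G w u))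
    reversed w x rewrite Graph.sym G u w | Graph.sym G w x | Graph.sym G x v =
      reverse-product (indicator (adj G w u)) (indicator (adj G x w)) (indicator (adj G v x))
      where
      reverse-product : ∀ a b c → a * (b * c) ≡ c * (b * a)
      reverse-product = solve-∀

  commonNbrs≡sum : ∀ u v →
    commonNbrs G u v ≡ ∑[ x < n ] (indicator (adj G u x) * indicator (adj G x v))
  commonNbrs≡sum u v = trans (count≡sum (isCommonNbr G u v)) (sum-cong-≗ λ x →
    trans (indicator-∧ (adj G u x) (adj G v x))
          (cong (λ b → indicator (adj G u x) * indicator b) (Graph.sym G v x)))

  walks₃≡sum-commonNbrs : ∀ u v →
    walks₃ G u v ≡ ∑[ w < n ] (indicator (adj G u w) * commonNbrs G w v)
  walks₃≡sum-commonNbrs u v = sum-cong-≗ λ w → begin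
    ∑[ x < n ] (indicator (adj G u w) * (indicator (adj G w x) * indicator (adj G x v)))
      ≡⟨ *-distribˡ-sum (indicator (adj G u w)) (λ x → indicator (adj G w x) * indicator (adj G x v)) ⟨
    indicator (adj G u w) * ∑[ x < n ] (indicator (adj G w x) * indicator (adj G x v))
      ≡⟨ cong (indicator (adj G u w) *_) (sym (commonNbrs≡sum w v)) ⟩
    indicator (adj G u w) * commonNbrs G w v ∎

  commonNbrs-self : ∀ v → commonNbrs G v v ≡ degree G v
  commonNbrs-self v = begin
    commonNbrs G v v                             ≡⟨ count≡sum (isCommonNbr G v v) ⟩
    ∑[ w < n ] indicator (adj G v w ∧ adj G v w) ≡⟨ sum-cong-≗ (cong indicator ∘ ∧-idem ∘ adj G v) ⟩
    ∑[ w < n ] indicator (adj G v w)             ≡⟨ count≡sum (adj G v) ⟨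
    degree G v                                   ∎

m+[2+k]*n≡n+[2+k]*m⇒m≡n : ∀ k {m n} → m + (2 + k) * n ≡ n + (2 + k) * m → m ≡ n
m+[2+k]*n≡n+[2+k]*m⇒m≡n k {m} {n} eq =
  sym (*-cancelˡ-≡ n m (suc k) (+-cancelˡ-≡ (m + n) _ _ (begin
    m + n + suc k * n   ≡⟨ regroupˡ k m n ⟩
    m + (2 + k) * n     ≡⟨ eq ⟩
    n + (2 + k) * m     ≡⟨ regroupʳ k m n ⟨
    m + n + suc k * m   ∎)))
  where
  open ≡-Reasoning
  regroupˡ : ∀ k m n → m + n + suc k * n ≡ m + (2 + k) * n
  regroupˡ = solve-∀
  regroupʳ : ∀ k m n → m + n + suc k * m ≡ n + (2 + k) * m
  regroupʳ = solve-∀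

module Regularity {n} (G : Graph n) (triangleFree : TriangleFree G) (k : ℕ)
  (μ : ∀ x y → x ≢ y → adj G x y ≡ false → commonNbrs G x y ≡ 2 + k) where

  open ≡-Reasoning

  private
    p = 2 + k

  walks₃-along-edge : ∀ {u v} → Adj G u v → walks₃ G u v + p ≡ degree G v + p * degree G u
  walks₃-along-edge {u} {v} uv = begin
    walks₃ G u v + p             ≡⟨ cong₂ _+_ (walks₃≡sum-commonNbrs G u v) (sym (*-identityʳ p)) ⟩
    sum s + p * 1                ≡⟨ cong (λ b → sum s + p * indicator b) uv ⟨
    sum s + p * t v              ≡⟨ sum-scaled-except-at p s t v s≡pt ⟩
    s v + p * sum t              ≡⟨ cong₂ (λ b c → b + p * c) s-at-v (sym (count≡sum (adj G u))) ⟩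
    degree G v + p * degree G u  ∎
    -- Split the walks u–w–x–v by w: w = v gives the degree of v, and every other neighbour w
    -- of u is, by triangle-freeness, a non-neighbour of v sharing exactly p neighbours with it.
    where
    t s : Vector ℕ n
    t w = indicator (adj G u w)
    s w = t w * commonNbrs G w v
    s-at-v : s v ≡ degree G v
    s-at-v rewrite uv = trans (+-identityʳ _) (commonNbrs-self G v)
    s≡pt : ∀ w → w ≢ v → s w ≡ p * t w
    s≡pt w w≢v with adj G u w in uw
    ... | false = sym (*-zeroʳ p)
    ... | true  = trans (+-identityʳ _) (trans (μ w v w≢v w≁v) (sym (*-identityʳ p)))
      where
      w≁v : adj G w v ≡ false
      w≁v = ¬-not (λ wv → triangleFree uw wv uv)

  degree-along-edge : ∀ {u v} → Adj G u v → degree G u ≡ degree G v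
  degree-along-edge {u} {v} uv = m+[2+k]*n≡n+[2+k]*m⇒m≡n k (begin
    degree G u + p * degree G v ≡⟨ walks₃-along-edge (adj-sym G uv) ⟨
    walks₃ G v u + p            ≡⟨ cong (_+ p) (walks₃-sym G v u) ⟩
    walks₃ G u v + p            ≡⟨ walks₃-along-edge uv ⟩
    degree G v + p * degree G u ∎)

  regular : ∀ a b → degree G a ≡ degree G b
  regular a b with a ≟ b | adj G a b in ab
  ... | yes refl | _     = refl
  ... | no _     | true  = degree-along-edge ab
  ... | no a≢b   | false
    with w , _ , w-common ← ≤count⇒injection {1} (isCommonNbr G a b)
                                               (subst (1 ≤_) (sym (μ a b a≢b ab)) (s≤s z≤n))
    = trans (degree-along-edge (common-nbrˡ G (w-common 0F)))
            (sym (degree-along-edge (common-nbrʳ G (w-common 0F))))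

uniquelySaturated⇒stronglyRegular : ∀ {n} (G : Graph n) k →
  UniquelySaturated (Book (2 + k)) G → Girth G 4 → ∃[ d ] StronglyRegular G n d 0 (2 + k)
uniquelySaturated⇒stronglyRegular G k (_ , saturated) ((c , c-inj , path , _) , no-short-cycle) =
  degree G (c 0F) , refl , non-edge , (c 0F , c 1F , path 0F) , (λ v → regular v (c 0F)) ,
  (λ _ _ → triangleFree⇒commonNbrs≡0 G triangleFree) , μ
  where
  triangleFree : TriangleFree G
  triangleFree = ¬cycle₃⇒triangleFree G (no-short-cycle 3 ≤-refl ≤-refl)
  μ : ∀ u v → u ≢ v → adj G u v ≡ false → commonNbrs G u v ≡ 2 + k
  μ u v u≢v u≁v = NewEdge.unique-copy⇒commonNbrs G u≢v triangleFree (saturated u v u≢v u≁v)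
  open Regularity G triangleFree k μ
  non-edge : ∃[ u ] ∃[ v ] (u ≢ v × adj G u v ≡ false)
  non-edge = c 0F , c 2F , (λ eq → case c-inj eq of λ ()) , ¬-not (triangleFree (path 0F) (path 1F))

stronglyRegular⇒uniquelySaturated : ∀ {n} (G : Graph n) k {d} → StronglyRegular G n d 0 (2 + k) →
  UniquelySaturated (Book (2 + k)) G × 2 + (2 + k) ≤ n × Girth G 4
stronglyRegular⇒uniquelySaturated G k (_ , (u , v , u≢v , u≁v) , _ , _ , λ≡0 , μ) =
  (book-free , saturated) , injective⇒≤ (proj₁ (proj₂ (proj₁ (saturated u v u≢v u≁v)))) ,
  cycle₄ , no-short-cycle
  where
  triangleFree : TriangleFree G
  triangleFree = commonNbrs≡0⇒triangleFree G λ≡0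
  saturated : ∀ x y (x≢y : x ≢ y) → adj G x y ≡ false →
    ExactlyOneCopy (Book (2 + k)) (addEdge G x y x≢y)
  saturated x y x≢y x≁y = NewEdge.commonNbrs⇒unique-copy G x≢y triangleFree (μ x y x≢y x≁y)
  book-free : ¬ Contains (Book (2 + k)) G
  book-free (_ , _ , f-hom) = triangleFree (f-hom 0F 1F refl) (f-hom 1F 2F refl) (f-hom 0F 2F refl)
  cycle₄ : HasCycle G 4
  cycle₄ with w , w-inj , w-common ← ≤count⇒injection {2} (isCommonNbr G u v)
                                       (subst (2 ≤_) (sym (μ u v u≢v u≁v)) (s≤s (s≤s z≤n)))
    = common-nbrs⇒cycle₄ G u≢v (λ eq → case w-inj eq of λ ()) (w-common 0F) (w-common 1F)
  no-short-cycle : ∀ l → 3 ≤ l → l < 4 → ¬ HasCycle G l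
  no-short-cycle l 3≤l l<4 rewrite ≤-antisym (s≤s⁻¹ l<4) 3≤l = triangleFree⇒¬cycle₃ G triangleFree

-- The hypothesis 3 ≤ p is only used to write p = 2 + k: the argument works for p ≥ 2.
mainTheorem16 : (p : ℕ) → 3 ≤ p → (n : ℕ) → (G : Graph n) →
    ((UniquelySaturated (Book p) G × 2 + p ≤ n × Girth G 4) ⇔ (∃[ k ] StronglyRegular G n k 0 p))
mainTheorem16 (suc (suc k)) _ n G = mk⇔
  (λ (saturated , _ , girth₄) → uniquelySaturated⇒stronglyRegular G k saturated girth₄)
  (λ (_ , stronglyRegular) → stronglyRegular⇒uniquelySaturated G k stronglyRegular)
mainTheorem16 1 (s≤s ()) _ _
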